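{- Let $f=C_1\wedge\dots\wedge C_k$ be a CNF formula over variables $x_1,\dots,x_n$ with literal set $L=\{x_1,\neg x_1,\dots,x_n,\neg x_n\}$, and let $\mathbb{K}_+$, $\mathbb{K}_-$ and $\mathcal{H}=\{\{C_1\},\dots,\{C_k\}\}$ be as constructed below. If $H$ is a minimal hypothesis of $\mathbb{K}_\pm$ with $H\notin\mathcal{H}$, then $H\subseteq L$.
   Context: Construction: $M=\{C_1,\dots,C_k\}\cup L$ (the $C_j$ as new attribute symbols). Positive context $\mathbb{K}_+=(G_+,M,\mathcal{I}_+)$ with $G_+=\{g_l\mid l\in L\}\cup\{g_{C_1},\dots,g_{C_k}\}$, where for $l\in L$: $g_l\,\mathcal{I}_+\,C_j$ iff $l$ does not occur in $C_j$, and $g_l\,\mathcal{I}_+\,l'$ ($l'\in L$) iff $l'\neq l$; the intent of $g_{C_j}$ is $\{C_j\}$. Negative context $\mathbb{K}_-=(G_-,M,\mathcal{I}_-)$ with $G_-=\{h_1,\dots,h_n\}$, the intent of $h_i$ being $L\setminus\{x_i,\neg x_i\}$. For a formal context $(G,M,I)$, $A'=\{m\mid gIm\ \forall g\in A\}$, $B'=\{g\mid gIm\ \forall m\in B\}$, and $B\subseteq M$ is an intent if $B''=B$. A (positive) hypothesis of $\mathbb{K}_\pm$ is an intent $H$ of $\mathbb{K}_+$ not contained in the intent of any $g\in G_-$ in $\mathbb{K}_-$; a minimal hypothesis is a hypothesis no proper subset of which is a hypothesis (if no hypothesis exists, the set of minimal hypotheses is $\{M\}$ by convention). -}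

module Defs where

open import Level using (0ℓ)
open import Data.Nat using (ℕ)
open import Data.Fin using (Fin)
open import Data.Bool using (Bool; true; false)
open import Data.List using (List)
open import Data.List.Membership.Propositional using (_∈_)
open import Data.Product using (_×_; Σ; ∃; _,_)
open import Data.Sum using (_⊎_; inj₁; inj₂)
open import Data.Empty using (⊥)
open import Data.Unit using (⊤)
open import Relation.Nullary using (¬_)
open import Relation.Binary.PropositionalEquality using (_≡_; _≢_)
open import Relation.Unary using (Pred; _⊆_; _⊂_; _≐_; ｛_｝) renaming (_∈_ to _∈ₚ_)

record Context : Set₁ where
  field
    Obj : Set
    Att : Set
    I   : Obj → Att → Set

module _ (K : Context) where
  open Context K

  extent : Pred Att 0ℓ → Pred Obj 0ℓ
  extent B g = ∀ m → B m → I g m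

  common : Pred Obj 0ℓ → Pred Att 0ℓ
  common A m = ∀ g → A g → I g m

  IsIntent : Pred Att 0ℓ → Set
  IsIntent B = common (extent B) ≐ B

  objIntent : Obj → Pred Att 0ℓ
  objIntent g m = I g m

record PMContext : Set₁ where
  field
    Att  : Set
    Obj₊ : Set
    I₊   : Obj₊ → Att → Set
    Obj₋ : Set
    I₋   : Obj₋ → Att → Set

  K₊ : Context
  K₊ = record { Obj = Obj₊ ; Att = Att ; I = I₊ }

  K₋ : Context
  K₋ = record { Obj = Obj₋ ; Att = Att ; I = I₋ }

  IsHypothesis : Pred Att 0ℓ → Set
  IsHypothesis H = IsIntent K₊ H × (∀ (g : Obj₋) → ¬ (H ⊆ objIntent K₋ g))

  -- minimal hypothesis, with the convention that if there is no
  -- hypothesis then the set of minimal hypotheses is {M}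
  IsMinimalHypothesis : Pred Att 0ℓ → Set₁
  IsMinimalHypothesis H =
      (IsHypothesis H × (∀ (H' : Pred Att 0ℓ) → H' ⊂ H → ¬ IsHypothesis H'))
    ⊎ ((∀ (H' : Pred Att 0ℓ) → ¬ IsHypothesis H') × (H ≐ (λ (_ : Att) → ⊤)))

-- literal over variables x_1..x_n : (variable index, polarity);
-- (i , true) is x_i and (i , false) is ¬ x_i
Lit : ℕ → Set
Lit n = Fin n × Bool

Clause : ℕ → Set
Clause n = List (Lit n)

CNF : ℕ → ℕ → Set
CNF n k = Fin k → Clause n

-- The construction.  M = {C_1..C_k} ∪ L, encoded as Fin k ⊎ Lit n.

Attr : ℕ → ℕ → Set
Attr n k = Fin k ⊎ Lit n

LitAttrs : (n k : ℕ) → Pred (Attr n k) 0ℓ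
LitAttrs n k (inj₁ _) = ⊥
LitAttrs n k (inj₂ _) = ⊤

PosObj : ℕ → ℕ → Set
PosObj n k = Lit n ⊎ Fin k

posI : ∀ {n k} → CNF n k → PosObj n k → Attr n k → Set
posI f (inj₁ l) (inj₁ j)  = ¬ (l ∈ f j)
posI f (inj₁ l) (inj₂ l') = l' ≢ l
posI f (inj₂ j) (inj₁ j') = j' ≡ j
posI f (inj₂ j) (inj₂ l') = ⊥

negI : ∀ {n k} → Fin n → Attr n k → Set
negI i (inj₁ _)       = ⊥
negI i (inj₂ (v , _)) = v ≢ i

Kpm : ∀ {n k} → CNF n k → PMContext
Kpm {n} {k} f = record
  { Att = Attr n k ; Obj₊ = PosObj n k ; I₊ = posI f
  ; Obj₋ = Fin n ; I₋ = negI }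

In𝓗 : ∀ {n k} → Pred (Attr n k) 0ℓ → Set
In𝓗 {n} {k} H = ∃ λ (j : Fin k) → H ≐ ｛ inj₁ j ｝

module Submission where

open import Defs
open import Level using (0ℓ)
open import Data.Nat using (ℕ)
open import Data.Fin using (Fin)
open import Data.Product using (_,_)
open import Data.Sum using (inj₁; inj₂)
open import Data.Unit using (tt)
open import Relation.Nullary using (¬_)
open import Relation.Unary using (Pred; _⊆_; _≐_; ｛_｝)
open import Relation.Binary.PropositionalEquality using (refl)

-- Every clause attribute C_j alone already forms a hypothesis, as the object
-- g_{C_j} has intent exactly {C_j} and no negative object has C_j.  Hence a
-- minimal hypothesis containing some C_j can be nothing but {C_j}, which lies in 𝓗.

singleton-isIntent : (K : Context) (g : Context.Obj K) (m : Context.Att K) →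
  objIntent K g ≐ ｛ m ｝ → IsIntent K ｛ m ｝
singleton-isIntent K g m (g⊆m , m⊆g) = closed , extensive
  where
  closed : common K (extent K ｛ m ｝) ⊆ ｛ m ｝
  closed a = g⊆m (a g λ { _ refl → m⊆g refl })

  extensive : ｛ m ｝ ⊆ common K (extent K ｛ m ｝)
  extensive refl _ g'∈extent = g'∈extent m refl

module _ (K : PMContext) where
  open PMContext K

  minimalHypothesis-⊆-hypothesis : ∀ {H S : Pred Att 0ℓ} →
    IsMinimalHypothesis H → IsHypothesis S → S ⊆ H → ¬ ¬ (H ⊆ S)
  minimalHypothesis-⊆-hypothesis (inj₁ (_ , minimal)) S-hyp S⊆H H⊈S =
    minimal _ (S⊆H , H⊈S) S-hyp
  minimalHypothesis-⊆-hypothesis (inj₂ (noHypothesis , _)) S-hyp _ _ =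
    noHypothesis _ S-hyp

module _ {n k : ℕ} (f : CNF n k) where
  open PMContext (Kpm f)

  clauseObj-intent : (j : Fin k) → objIntent K₊ (inj₂ j) ≐ ｛ inj₁ j ｝
  clauseObj-intent j = (λ { {inj₁ _} refl → refl }) , λ { refl → refl }

  clause-singleton-isHypothesis : (j : Fin k) → IsHypothesis ｛ inj₁ j ｝
  clause-singleton-isHypothesis j =
    singleton-isIntent K₊ (inj₂ j) (inj₁ j) (clauseObj-intent j) , λ _ C⊆h → C⊆h refl

proposition1 : (n k : ℕ) (f : CNF n k) (H : Pred (Attr n k) 0ℓ) →
    PMContext.IsMinimalHypothesis (Kpm f) H → ¬ In𝓗 H → H ⊆ LitAttrs n k
proposition1 n k f H minimal H∉𝓗 {inj₁ j} Cj∈H =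
  minimalHypothesis-⊆-hypothesis (Kpm f) minimal
    (clause-singleton-isHypothesis f j) (λ { refl → Cj∈H })
    λ H⊆Cj → H∉𝓗 (j , H⊆Cj , λ { refl → Cj∈H })
proposition1 n k f H _ _ {inj₂ _} _ = tt
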